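{- Let $\Omega$ be a set of orderings and let $(x,Y)$ be a ladder in $\Omega$, where $Y=(y_0,\dots,y_{k-1})$ has length $k\ge 1$. Then $\Pr[y_{k-1}<x]\le\frac12$.
   Context: A set of orderings $\Omega$ on a finite set $S$ is a nonempty set of total orderings of $S$. For distinct elements $a,b$, $\Pr[a<b]$ is the probability that $a$ occurs earlier than $b$ in a uniformly random ordering from $\Omega$. For an element $x$ and a nonempty sequence $Y=(y_0,\dots,y_{k-1})$ of distinct elements, $(x,Y)$ is a ladder in $\Omega$ if: (1) in every ordering of $\Omega$, the elements of $Y$ occurring earlier than $x$ occur in the order given by $Y$; (2) whenever $w\in\Omega$ has some elements of $Y$ earlier than $x$ and $i$ is the largest index with $y_i$ earlier than $x$ in $w$, the ordering obtained by swapping $x$ and $y_i$ in $w$ belongs to $\Omega$. -}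

module Defs where

open import Data.Nat using (ℕ; zero; suc)
open import Data.Integer using (+_)
open import Data.Fin using (Fin; _<_; _≟_)
open import Data.Fin.Properties using (any?; _<?_)
open import Data.Vec using (Vec; lookup; map)
open import Data.List using (List; length; filter)
open import Data.List.Membership.Propositional using (_∈_)
open import Data.List.Relation.Unary.All using (All)
open import Data.List.Relation.Unary.Unique.Propositional using (Unique)
open import Data.Product using (_×_; ∃; _,_)
open import Data.Rational using (ℚ; _/_; 0ℚ)
open import Relation.Binary.PropositionalEquality using (_≡_)
open import Relation.Nullary using (Dec; yes; no)
open import Relation.Nullary.Decidable using (_×-dec_)

-- The ground set S is Fin n.  An ordering of S is written as the vector
-- listing the elements of S in order (position ↦ element); it must list
-- every element exactly once (length n and injective).
IsOrdering : {n : ℕ} → Vec (Fin n) n → Set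
IsOrdering {n} w = (i j : Fin n) → lookup w i ≡ lookup w j → i ≡ j

IsSetOfOrderings : {n : ℕ} → List (Vec (Fin n) n) → Set
IsSetOfOrderings Ω = All IsOrdering Ω × Unique Ω × (length Ω ≡ 0 → Data.Empty.⊥)
  where import Data.Empty

Before : {n : ℕ} → Vec (Fin n) n → Fin n → Fin n → Set
Before w a b = ∃ λ i → ∃ λ j → i < j × lookup w i ≡ a × lookup w j ≡ b

before? : {n : ℕ} (w : Vec (Fin n) n) (a b : Fin n) → Dec (Before w a b)
before? w a b = any? λ i → any? λ j → (i <? j) ×-dec ((lookup w i ≟ a) ×-dec (lookup w j ≟ b))

-- ratio c d = c / d as a rational (0 if d = 0, never used that way)
ratio : ℕ → ℕ → ℚ
ratio c zero    = 0ℚ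
ratio c (suc d) = + c / suc d

Pr : {n : ℕ} → List (Vec (Fin n) n) → Fin n → Fin n → ℚ
Pr Ω a b = ratio (length (filter (λ w → before? w a b) Ω)) (length Ω)

swapElem : {n : ℕ} → Fin n → Fin n → Fin n → Fin n
swapElem a b z with z ≟ a
... | yes _ = b
... | no _ with z ≟ b
...   | yes _ = a
...   | no _  = z

swapIn : {n : ℕ} → Fin n → Fin n → Vec (Fin n) n → Vec (Fin n) n
swapIn a b w = map (swapElem a b) w

IsLadder : {n m : ℕ} → List (Vec (Fin n) n) → Fin n → Vec (Fin n) m → Set
IsLadder {n} {m} Ω x Y =
  ((w : Vec (Fin n) n) → w ∈ Ω → (i j : Fin m) → i < j →
     Before w (lookup Y i) x → Before w (lookup Y j) x →
     Before w (lookup Y i) (lookup Y j))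
  ×
  ((w : Vec (Fin n) n) → w ∈ Ω → (i : Fin m) →
     Before w (lookup Y i) x →
     ((j : Fin m) → i < j → Before w (lookup Y j) x → Data.Empty.⊥) →
     swapIn x (lookup Y i) w ∈ Ω)
  where import Data.Empty

module Submission where

-- Let y = y_{k-1} be the last element of the ladder (x , Y).  Split Ω into
-- A = {w | y is earlier than x in w} and its complement B.  Because y is the
-- last element of Y, whenever y is earlier than x it is the largest-index
-- element of Y earlier than x, so ladder condition (2) says that swapping x and
-- y maps A into Ω; swapping reverses the relative order of x and y, so it even
-- maps A into B.  Swapping two values is an involution, hence injective, and Ω
-- has no duplicates, so |A| ≤ |B|, i.e. 2|A| ≤ |Ω|, which is Pr[y < x] ≤ ½.

open import Defs
open import Data.Nat using (ℕ; suc)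
open import Data.Fin using (Fin; fromℕ)
open import Data.Vec using (Vec; lookup)
open import Data.List using (List)
open import Data.Rational using (_≤_; ½)
open import Relation.Binary.PropositionalEquality using (_≡_)
open import Relation.Nullary using (¬_)

import Data.Nat as ℕ
import Data.Nat.Properties as ℕ
import Data.Fin as Fin
import Data.Fin.Properties as Fin
import Data.Vec as Vec
import Data.Vec.Properties as Vec
open import Data.List using (_∷_; []; length; filter; map)
open import Data.List.Properties using (length-map)
open import Data.List.Membership.Propositional using (_∈_)
open import Data.List.Membership.Propositional.Properties using (∈-map⁻; ∈-filter⁺; ∈-filter⁻)
open import Data.List.Relation.Binary.Subset.Propositional using (_⊆_)
open import Data.List.Relation.Unary.Any using (here; there)
open import Data.List.Relation.Unary.All as All using (All)
open import Data.List.Relation.Unary.AllPairs using (_∷_)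
open import Data.List.Relation.Unary.Unique.Propositional using (Unique)
import Data.List.Relation.Unary.Unique.Propositional.Properties as Unique
open import Data.Product using (_×_; _,_)
open import Data.Empty using (⊥-elim)
open import Function.Definitions using (Injective)
open import Relation.Binary.PropositionalEquality
  using (refl; sym; trans; cong; subst; subst₂; _≢_; module ≡-Reasoning)
open import Relation.Nullary using (Dec; yes; no)
open import Relation.Unary.Properties using (∁?)
import Data.Integer as ℤ
import Data.Integer.Properties as ℤ
import Data.Rational as ℚ
import Data.Rational.Properties as ℚ
import Data.Rational.Unnormalised as ℚᵘ
import Data.Rational.Unnormalised.Properties as ℚᵘ

module _ {A : Set} where

  remove : {x : A} (ys : List A) → x ∈ ys → List A
  remove (_ ∷ ys) (here _)  = ys
  remove (y ∷ ys) (there p) = y ∷ remove ys p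

  length-remove : {x : A} (ys : List A) (p : x ∈ ys) → suc (length (remove ys p)) ≡ length ys
  length-remove (_ ∷ ys) (here _)  = refl
  length-remove (y ∷ ys) (there p) = cong suc (length-remove ys p)

  ∈-remove : {x z : A} (ys : List A) (p : x ∈ ys) → z ∈ ys → x ≢ z → z ∈ remove ys p
  ∈-remove (_ ∷ ys) (here refl) (here refl) x≢z = ⊥-elim (x≢z refl)
  ∈-remove (_ ∷ ys) (here refl) (there q)   _   = q
  ∈-remove (y ∷ ys) (there p)   (here refl) _   = here refl
  ∈-remove (y ∷ ys) (there p)   (there q)   x≢z = there (∈-remove ys p q x≢z)

  pigeonhole : {xs ys : List A} → Unique xs → xs ⊆ ys → length xs ℕ.≤ length ys
  pigeonhole {[]}     _                 _  = ℕ.z≤n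
  pigeonhole {x ∷ xs} {ys} (x∉xs ∷ uniq) xs⊆ys =
    subst (suc (length xs) ℕ.≤_) (length-remove ys x∈ys)
      (ℕ.s≤s (pigeonhole uniq (λ z∈xs → ∈-remove ys x∈ys (xs⊆ys (there z∈xs)) (All.lookup x∉xs z∈xs))))
    where x∈ys = xs⊆ys (here refl)

  module _ {P : A → Set} (P? : (a : A) → Dec (P a)) where

    length-filter-∁ : (xs : List A) →
      length (filter P? xs) ℕ.+ length (filter (∁? P?) xs) ≡ length xs
    length-filter-∁ []       = refl
    length-filter-∁ (x ∷ xs) with P? x
    ... | yes _ = cong suc (length-filter-∁ xs)
    ... | no _  = trans (ℕ.+-suc _ _) (cong suc (length-filter-∁ xs))

    at-most-half : {xs : List A} (f : A → A) → Unique xs → Injective _≡_ _≡_ f →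
      (∀ {w} → w ∈ xs → P w → f w ∈ xs × ¬ P (f w)) →
      length (filter P? xs) ℕ.+ length (filter P? xs) ℕ.≤ length xs
    at-most-half {xs} f uniq f-inj f-flips =
      subst (length As ℕ.+ length As ℕ.≤_) (length-filter-∁ xs)
        (ℕ.+-monoʳ-≤ (length As) |As|≤|Bs|)
      where
      As = filter P? xs
      Bs = filter (∁? P?) xs
      fAs⊆Bs : map f As ⊆ Bs
      fAs⊆Bs fw∈fAs with ∈-map⁻ f fw∈fAs
      ... | w , w∈As , refl with ∈-filter⁻ P? w∈As
      ...   | w∈xs , Pw with f-flips w∈xs Pw
      ...     | fw∈xs , ¬Pfw = ∈-filter⁺ (∁? P?) fw∈xs ¬Pfw
      |As|≤|Bs| : length As ℕ.≤ length Bs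
      |As|≤|Bs| = subst (ℕ._≤ length Bs) (length-map f As)
        (pigeonhole (Unique.map⁺ f-inj (Unique.filter⁺ P? uniq)) fAs⊆Bs)

-- For d > 0 both c / d and ½ are normalisations of unnormalised fractions, so
-- the comparison is the cross-multiplied inequality c · 2 ≤ 1 · d.
ratio≤½ : (c d : ℕ) → c ℕ.+ c ℕ.≤ d → ratio c d ≤ ½
ratio≤½ _ ℕ.zero    _     = ℚ.*≤* (ℤ.+≤+ ℕ.z≤n)
ratio≤½ c (suc d) c+c≤d =
  ℚ.toℚᵘ-cancel-≤ (ℚᵘ.≤-respˡ-≃ (ℚᵘ.≃-sym (ℚ.toℚᵘ-fromℚᵘ (ℚᵘ.mkℚᵘ (ℤ.+ c) d)))
    (ℚᵘ.≤-respʳ-≃ (ℚᵘ.≃-sym (ℚ.toℚᵘ-fromℚᵘ (ℚᵘ.mkℚᵘ (ℤ.+ 1) 1)))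
      (ℚᵘ.*≤* (subst₂ ℤ._≤_ (ℤ.pos-* c 2) (ℤ.pos-* 1 (suc d)) (ℤ.+≤+ cross-multiplied)))))
  where
  open ≡-Reasoning
  twice : c ℕ.* 2 ≡ c ℕ.+ c
  twice = begin
    c ℕ.* 2           ≡⟨ ℕ.*-comm c 2 ⟩
    c ℕ.+ (c ℕ.+ 0)   ≡⟨ cong (c ℕ.+_) (ℕ.+-identityʳ c) ⟩
    c ℕ.+ c           ∎
  cross-multiplied : c ℕ.* 2 ℕ.≤ 1 ℕ.* suc d
  cross-multiplied = subst₂ ℕ._≤_ (sym twice) (sym (ℕ.*-identityˡ (suc d))) c+c≤d

module _ {n : ℕ} (a b : Fin n) where

  swap-fst : swapElem a b a ≡ b
  swap-fst with a Fin.≟ a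
  ... | yes _   = refl
  ... | no a≢a  = ⊥-elim (a≢a refl)

  swap-snd : swapElem a b b ≡ a
  swap-snd with b Fin.≟ a
  ... | yes b≡a = b≡a
  ... | no _ with b Fin.≟ b
  ...   | yes _   = refl
  ...   | no b≢b  = ⊥-elim (b≢b refl)

  swap-other : {z : Fin n} → z ≢ a → z ≢ b → swapElem a b z ≡ z
  swap-other {z} z≢a z≢b with z Fin.≟ a
  ... | yes z≡a = ⊥-elim (z≢a z≡a)
  ... | no _ with z Fin.≟ b
  ...   | yes z≡b = ⊥-elim (z≢b z≡b)
  ...   | no _    = refl

  swap-involutive : (z : Fin n) → swapElem a b (swapElem a b z) ≡ z
  swap-involutive z = by-cases (z Fin.≟ a) (z Fin.≟ b)
    where
    by-cases : Dec (z ≡ a) → Dec (z ≡ b) → swapElem a b (swapElem a b z) ≡ z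
    by-cases (yes refl) _          = trans (cong (swapElem a b) swap-fst) swap-snd
    by-cases (no _)     (yes refl) = trans (cong (swapElem a b) swap-snd) swap-fst
    by-cases (no z≢a)   (no z≢b)   = trans (cong (swapElem a b) (swap-other z≢a z≢b)) (swap-other z≢a z≢b)

  swap-injective : Injective _≡_ _≡_ (swapElem a b)
  swap-injective {z} {z′} eq = begin
    z                                  ≡⟨ sym (swap-involutive z) ⟩
    swapElem a b (swapElem a b z)      ≡⟨ cong (swapElem a b) eq ⟩
    swapElem a b (swapElem a b z′)     ≡⟨ swap-involutive z′ ⟩
    z′                                 ∎
    where open ≡-Reasoning

  swapIn-involutive : (w : Vec (Fin n) n) → swapIn a b (swapIn a b w) ≡ w
  swapIn-involutive w = begin
    Vec.map (swapElem a b) (Vec.map (swapElem a b) w)  ≡⟨ Vec.map-∘ (swapElem a b) (swapElem a b) w ⟨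
    Vec.map (λ z → swapElem a b (swapElem a b z)) w     ≡⟨ Vec.map-cong swap-involutive w ⟩
    Vec.map (λ z → z) w                                 ≡⟨ Vec.map-id w ⟩
    w                                                   ∎
    where open ≡-Reasoning

  swapIn-injective : Injective _≡_ _≡_ (swapIn a b)
  swapIn-injective {w} {w′} eq = begin
    w                          ≡⟨ sym (swapIn-involutive w) ⟩
    swapIn a b (swapIn a b w)  ≡⟨ cong (swapIn a b) eq ⟩
    swapIn a b (swapIn a b w′) ≡⟨ swapIn-involutive w′ ⟩
    w′                         ∎
    where open ≡-Reasoning

  swapIn-reverses : (w : Vec (Fin n) n) → IsOrdering w → Before w b a → ¬ Before (swapIn a b w) b a
  swapIn-reverses w ord (i , j , i<j , wi≡b , wj≡a) (i′ , j′ , i′<j′ , w′i′≡b , w′j′≡a) =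
    Fin.<-asym i<j (subst₂ Fin._<_ (ord i′ j wi′≡wj) (ord j′ i wj′≡wi) i′<j′)
    where
    swapped : (p : Fin n) → lookup (swapIn a b w) p ≡ swapElem a b (lookup w p)
    swapped p = Vec.lookup-map p (swapElem a b) w
    wi′≡wj : lookup w i′ ≡ lookup w j
    wi′≡wj = trans (swap-injective (trans (sym (swapped i′)) (trans w′i′≡b (sym swap-fst)))) (sym wj≡a)
    wj′≡wi : lookup w j′ ≡ lookup w i
    wj′≡wi = trans (swap-injective (trans (sym (swapped j′)) (trans w′j′≡a (sym swap-snd)))) (sym wi≡b)

-- For the last element y_{k-1} of a ladder there is no later element of Y, so
-- ladder condition (2) applies whenever y_{k-1} is earlier than x.
ladder-last-swap : {n k : ℕ} {Ω : List (Vec (Fin n) n)} {x : Fin n} {Y : Vec (Fin n) (suc k)} →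
  IsLadder Ω x Y → {w : Vec (Fin n) n} → w ∈ Ω → Before w (lookup Y (fromℕ k)) x →
  swapIn x (lookup Y (fromℕ k)) w ∈ Ω
ladder-last-swap (_ , swap-closed) w∈Ω before =
  swap-closed _ w∈Ω (fromℕ _) before (λ j last<j _ → ℕ.<⇒≱ last<j (Fin.≤fromℕ j))

lemma4 : (n k : ℕ) (Ω : List (Vec (Fin n) n)) (x : Fin n) (Y : Vec (Fin n) (suc k)) →
    IsSetOfOrderings Ω →
    ((i j : Fin (suc k)) → lookup Y i ≡ lookup Y j → i ≡ j) →
    ((i : Fin (suc k)) → ¬ (lookup Y i ≡ x)) →
    IsLadder Ω x Y →
    Pr Ω (lookup Y (fromℕ k)) x ≤ ½
lemma4 n k Ω x Y (orderings , uniq , _) _ _ ladder =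
  ratio≤½ _ _ (at-most-half y-before-x? (swapIn x y) uniq (swapIn-injective x y) swap-flips)
  where
  y = lookup Y (fromℕ k)
  y-before-x? : (w : Vec (Fin n) n) → Dec (Before w y x)
  y-before-x? w = before? w y x
  swap-flips : ∀ {w} → w ∈ Ω → Before w y x → swapIn x y w ∈ Ω × ¬ Before (swapIn x y w) y x
  swap-flips {w} w∈Ω before =
    ladder-last-swap {Y = Y} ladder w∈Ω before , swapIn-reverses x y w (All.lookup orderings w∈Ω) before
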